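{- Let $\pi$ be a permutation of $[n]$ and let $\rho:[n]\to\mathbb{N}$ be a pile assignment function that sorts $\pi$ on queues, with $\rho(1)=1$. Then $$\rho(n)\ \ge\ 1+\mathrm{desc}(\pi)=\mathrm{ascrun}(\pi)=\mathrm{read}(\pi^{ -1}).$$
   Context: A deck of cards labelled by $[n]$ is represented by a permutation $\pi$ of $[n]$ with $\pi(s)$ the position (from the top) of label $s$. The queue shuffle of $\pi$ with pile assignments $\rho:[n]\to\mathbb{N}$ is the unique permutation $\sigma$ of $[n]$ with $\sigma(s)<\sigma(t)$ iff $(\rho(s),\pi(s))<(\rho(t),\pi(t))$ lexicographically; $\rho$ sorts $\pi$ on queues if $\sigma$ is the identity. $\mathrm{desc}(\pi)=\sum_{s=1}^{n-1}[\pi(s+1)<\pi(s)]$ is the number of descents of the sequence $(\pi(1),\dots,\pi(n))$, where $[P]$ is the indicator of $P$; $\mathrm{ascrun}(\pi)$ is the number of ascending runs (maximal contiguous increasing segments) of that sequence. For the sequence $\pi^{ -1}=(\pi^{ -1}(1),\dots,\pi^{ -1}(n))$ (the labels listed from top to bottom of the deck), $\mathrm{read}(\pi^{ -1})$ is its number of readings: the number of left-to-right passes through the sequence needed to find the numbers $1,2,\dots,n$ in this order without ever moving backwards within a pass. -}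

module Defs where

open import Data.Bool using (Bool; true; false; if_then_else_; _∧_; _∨_; not)
open import Data.Nat using (ℕ; zero; suc; _+_; _∸_; _<_; _≤_; _<ᵇ_; _≤ᵇ_; _≡ᵇ_; _<?_)
open import Data.Fin using (Fin; toℕ; fromℕ<)
open import Data.Fin.Permutation using (Permutation′; _⟨$⟩ʳ_; _⟨$⟩ˡ_)
import Data.Fin.Permutation as Perm
open import Data.List using (List; []; _∷_; map; upTo; concatMap; foldl)
open import Data.Nat.ListAction using (sum)
open import Data.List using () renaming (all to allL)
open import Data.Product using (_×_; _,_)
open import Data.Sum using (_⊎_)
open import Function.Bundles using (_⇔_)
open import Relation.Binary.PropositionalEquality using (_≡_)
open import Relation.Nullary using (yes; no)

-- Labels s ∈ [n] are represented by Fin n (label s+1 ↔ index s), likewise positions.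

LexLt : ℕ × ℕ → ℕ × ℕ → Set
LexLt (a , b) (c , d) = a < c ⊎ (a ≡ c × b < d)

IsQueueShuffle : {n : ℕ} → Permutation′ n → (Fin n → ℕ) → Permutation′ n → Set
IsQueueShuffle {n} π ρ σ =
  (s t : Fin n) →
  (toℕ (σ ⟨$⟩ʳ s) < toℕ (σ ⟨$⟩ʳ t)) ⇔ LexLt (ρ s , toℕ (π ⟨$⟩ʳ s)) (ρ t , toℕ (π ⟨$⟩ʳ t))

SortsOnQueues : {n : ℕ} → Permutation′ n → (Fin n → ℕ) → Set
SortsOnQueues π ρ = IsQueueShuffle π ρ Perm.id

-- a function on Fin n viewed as a 0-indexed sequence x₀ … x_{n-1} (0 outside)
toSeq : {n : ℕ} → (Fin n → ℕ) → ℕ → ℕ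
toSeq {n} f i with i <? n
... | yes p = f (fromℕ< p)
... | no _ = 0

range : ℕ → ℕ → List ℕ
range a b = map (a +_) (upTo (b ∸ a))

descSeq : ℕ → (ℕ → ℕ) → ℕ
descSeq n x = sum (map (λ s → if x (suc s) <ᵇ x s then 1 else 0) (upTo (n ∸ 1)))

incSeg : (ℕ → ℕ) → ℕ → ℕ → Bool
incSeg x a b = allL (λ i → x i <ᵇ x (suc i)) (range a b)

isRun : ℕ → (ℕ → ℕ) → ℕ → ℕ → Bool
isRun n x a b =
  (a ≤ᵇ b) ∧ (b <ᵇ n) ∧ incSeg x a b
  ∧ leftMax a ∧ ((suc b ≡ᵇ n) ∨ not (x b <ᵇ x (suc b)))
  where
    leftMax : ℕ → Bool
    leftMax zero = true
    leftMax (suc a′) = not (x a′ <ᵇ x (suc a′))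

ascrunSeq : ℕ → (ℕ → ℕ) → ℕ
ascrunSeq n x =
  sum (concatMap (λ a → map (λ b → if isRun n x a b then 1 else 0) (upTo n)) (upTo n))

-- one left-to-right pass over w₀ … w_{n-1} looking for k, k+1, … in order;
-- returns the next value still to be found
pass : ℕ → (ℕ → ℕ) → ℕ → ℕ
pass n w k = foldl (λ t i → if w i ≡ᵇ t then suc t else t) k (upTo n)

-- number of passes needed to find 0, 1, …, n-1 (labels are 0-indexed);
-- fuel n suffices for permutations, since every pass finds at least one value
passes : ℕ → (ℕ → ℕ) → ℕ → ℕ → ℕ
passes n w zero k = 0
passes n w (suc fuel) k = if n ≤ᵇ k then 0 else suc (passes n w fuel (pass n w k))

readSeq : ℕ → (ℕ → ℕ) → ℕ
readSeq n w = passes n w n 0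

desc : {n : ℕ} → Permutation′ n → ℕ
desc {n} π = descSeq n (toSeq (λ s → toℕ (π ⟨$⟩ʳ s)))

ascrun : {n : ℕ} → Permutation′ n → ℕ
ascrun {n} π = ascrunSeq n (toSeq (λ s → toℕ (π ⟨$⟩ʳ s)))

readInv : {n : ℕ} → Permutation′ n → ℕ
readInv {n} π = readSeq n (toSeq (λ p → toℕ (π ⟨$⟩ˡ p)))

-- Write x i for the position of label i. Since ρ sorts π on queues, consecutive labels i, i+1
-- satisfy (ρ i, x i) <lex (ρ (i+1), x (i+1)), so ρ increases by at least one at every descent
-- of x and telescoping gives the bound on ρ at the last label. An ascending run of x is
-- determined by its first index, and the first indices are 0 together with the successors of
-- the descents. Finally, a pass through the deck looking for label k finds label j+1 right after
-- label j exactly when x j < x (j+1), so it collects precisely the ascending run of x starting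
-- at k: every reading consumes one run.
module Submission where

open import Defs
open import Data.Nat using (ℕ; suc; _+_; _≤_)
open import Data.Fin using (Fin; zero; fromℕ)
open import Data.Fin.Permutation using (Permutation′)
open import Data.Product using (_×_)
open import Relation.Binary.PropositionalEquality using (_≡_)

open import Data.Bool using (Bool; true; false; T; not; _∧_; _∨_; if_then_else_)
open import Data.Empty using (⊥-elim)
open import Data.Fin using (toℕ; fromℕ<)
open import Data.Fin.Permutation using (_⟨$⟩ʳ_; _⟨$⟩ˡ_; inverseˡ; inverseʳ)
open import Data.Fin.Properties using (toℕ<n; toℕ-fromℕ<; fromℕ<-toℕ; toℕ-fromℕ)
open import Data.List using (List; []; _∷_; map; upTo; applyUpTo; concatMap; foldl)
open import Data.List.Properties using (map-upTo; upTo-∷ʳ; foldl-∷ʳ)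
open import Data.List.Relation.Unary.All.Properties using (all⁺; all⁻; map⁺; map⁻; applyUpTo⁺₁; applyUpTo⁻)
open import Data.Nat using (zero; _∸_; _<_; _<ᵇ_; _≤ᵇ_; _≡ᵇ_; _<?_; _≤?_; _≟_; z≤n; s≤s; z<s; s≤s⁻¹)
open import Data.Nat.ListAction using (sum)
open import Data.Nat.ListAction.Properties using (sum-++)
open import Data.Nat.Properties
open import Data.Product using (Σ; _,_; proj₁; proj₂)
open import Data.Sum using (inj₁; inj₂)
open import Data.Unit using (tt)
open import Function using (_∘_; id; Equivalence)
open import Relation.Binary.PropositionalEquality using (_≢_; refl; sym; trans; cong; cong₂; subst; subst₂; module ≡-Reasoning)
open import Relation.Binary.Definitions using (tri<; tri≈; tri>)
open import Relation.Nullary using (¬_; yes; no)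
open import Relation.Nullary.Decidable using (dec-true; dec-false; T?)

ind : Bool → ℕ
ind b = if b then 1 else 0

ind-T : ∀ {b} → T b → ind b ≡ 1
ind-T {true} _ = refl

ind-¬T : ∀ {b} → ¬ T b → ind b ≡ 0
ind-¬T {true}  ¬b = ⊥-elim (¬b tt)
ind-¬T {false} _  = refl

ind-not : ∀ {b} → T b → ind (not b) ≡ 0
ind-not {true} _ = refl

ind≤1 : ∀ b → ind b ≤ 1
ind≤1 true  = ≤-refl
ind≤1 false = z≤n

T-∧⁺ : ∀ {p q} → T p → T q → T (p ∧ q)
T-∧⁺ {true} _ q = q

T-∧⁻ : ∀ {p q} → T (p ∧ q) → T p × T q
T-∧⁻ {true} q = tt , q

T-∨⁺ˡ : ∀ {p q} → T p → T (p ∨ q)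
T-∨⁺ˡ {true} _ = tt

T-∨⁻ʳ : ∀ {p q} → T (p ∨ q) → ¬ T p → T q
T-∨⁻ʳ {true}  _ ¬p = ⊥-elim (¬p tt)
T-∨⁻ʳ {false} q _  = q

T-∨-not : ∀ {p q} → T (p ∨ not q) → T q → T p
T-∨-not {true} _ _ = tt
T-∨-not {false} {false} _ ()

¬T-∨-not : ∀ {p q} → ¬ T (p ∨ not q) → T q
¬T-∨-not {true}          ¬h = ⊥-elim (¬h tt)
¬T-∨-not {false} {true}  _  = tt
¬T-∨-not {false} {false} ¬h = ⊥-elim (¬h tt)

not-<ᵇ : ∀ {m n} → m ≢ n → not (m <ᵇ n) ≡ (n <ᵇ m)
not-<ᵇ {m} {n} m≢n with <-cmp m n
... | tri< m<n _ n≮m = trans (cong not (dec-true (m <? n) m<n)) (sym (dec-false (n <? m) n≮m))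
... | tri≈ _ m≡n _    = ⊥-elim (m≢n m≡n)
... | tri> m≮n _ n<m = trans (cong not (dec-false (m <? n) m≮n)) (sym (dec-true (n <? m) n<m))

sumFrom : (ℕ → ℕ) → ℕ → ℕ → ℕ
sumFrom f k zero    = 0
sumFrom f k (suc c) = f k + sumFrom f (suc k) c

sumFrom-suc : ∀ f k c → sumFrom f (suc k) c ≡ sumFrom (f ∘ suc) k c
sumFrom-suc f k zero    = refl
sumFrom-suc f k (suc c) = cong (f (suc k) +_) (sumFrom-suc f (suc k) c)

sum-applyUpTo : ∀ f c → sum (applyUpTo f c) ≡ sumFrom f 0 c
sum-applyUpTo f zero    = refl
sum-applyUpTo f (suc c) =
  cong (f 0 +_) (trans (sum-applyUpTo (f ∘ suc) c) (sym (sumFrom-suc f 0 c)))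

sum-map-upTo : ∀ f c → sum (map f (upTo c)) ≡ sumFrom f 0 c
sum-map-upTo f c = trans (cong sum (map-upTo f c)) (sum-applyUpTo f c)

sum-concatMap : ∀ {A : Set} (f : A → List ℕ) xs → sum (concatMap f xs) ≡ sum (map (sum ∘ f) xs)
sum-concatMap f []       = refl
sum-concatMap f (a ∷ as) =
  trans (sum-++ (f a) (concatMap f as)) (cong (sum (f a) +_) (sum-concatMap f as))

sumFrom-cong : ∀ {f g} k c → (∀ {i} → k ≤ i → i < k + c → f i ≡ g i) →
               sumFrom f k c ≡ sumFrom g k c
sumFrom-cong k zero    eq = refl
sumFrom-cong k (suc c) eq =
  cong₂ _+_ (eq ≤-refl (m<m+n k z<s))
            (sumFrom-cong (suc k) c λ {i} k<i i<1+k+c →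
              eq (<⇒≤ k<i) (subst (i <_) (sym (+-suc k c)) i<1+k+c))

sumFrom-0 : ∀ k c → sumFrom (λ _ → 0) k c ≡ 0
sumFrom-0 k zero    = refl
sumFrom-0 k (suc c) = sumFrom-0 (suc k) c

sumFrom-≡0 : ∀ {f} k c → (∀ {i} → k ≤ i → i < k + c → f i ≡ 0) → sumFrom f k c ≡ 0
sumFrom-≡0 k c eq = trans (sumFrom-cong k c eq) (sumFrom-0 k c)

sumFrom-+ : ∀ f k c d → sumFrom f k (c + d) ≡ sumFrom f k c + sumFrom f (k + c) d
sumFrom-+ f k zero    d = cong (λ j → sumFrom f j d) (sym (+-identityʳ k))
sumFrom-+ f k (suc c) d = begin
    f k + sumFrom f (suc k) (c + d)
  ≡⟨ cong (f k +_) (sumFrom-+ f (suc k) c d) ⟩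
    f k + (sumFrom f (suc k) c + sumFrom f (suc k + c) d)
  ≡⟨ +-assoc (f k) _ _ ⟨
    f k + sumFrom f (suc k) c + sumFrom f (suc k + c) d
  ≡⟨ cong (λ j → f k + sumFrom f (suc k) c + sumFrom f j d) (+-suc k c) ⟨
    f k + sumFrom f (suc k) c + sumFrom f (k + suc c) d
  ∎
  where open ≡-Reasoning

sumFrom-split : ∀ f {k j l} → k ≤ j → j ≤ l →
                sumFrom f k (l ∸ k) ≡ sumFrom f k (j ∸ k) + sumFrom f j (l ∸ j)
sumFrom-split f {k} {j} {l} k≤j j≤l = begin
    sumFrom f k (l ∸ k)
  ≡⟨ cong (λ i → sumFrom f k (i ∸ k)) (m+[n∸m]≡n j≤l) ⟨
    sumFrom f k (j + (l ∸ j) ∸ k)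
  ≡⟨ cong (sumFrom f k) (+-∸-comm (l ∸ j) k≤j) ⟩
    sumFrom f k (j ∸ k + (l ∸ j))
  ≡⟨ sumFrom-+ f k (j ∸ k) (l ∸ j) ⟩
    sumFrom f k (j ∸ k) + sumFrom f (k + (j ∸ k)) (l ∸ j)
  ≡⟨ cong (λ i → sumFrom f k (j ∸ k) + sumFrom f i (l ∸ j)) (m+[n∸m]≡n k≤j) ⟩
    sumFrom f k (j ∸ k) + sumFrom f j (l ∸ j)
  ∎
  where open ≡-Reasoning

sumFrom-ind-unique : ∀ (p : ℕ → Bool) {e n} → e < n → T (p e) → (∀ {b} → T (p b) → b ≡ e) →
                     sumFrom (ind ∘ p) 0 n ≡ 1
sumFrom-ind-unique p {e} {n} e<n pe unique = begin
    sumFrom (ind ∘ p) 0 n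
  ≡⟨ cong (sumFrom _ 0) e+[1+d]≡n ⟨
    sumFrom (ind ∘ p) 0 (e + suc d)
  ≡⟨ sumFrom-+ _ 0 e (suc d) ⟩
    sumFrom (ind ∘ p) 0 e + (ind (p e) + sumFrom (ind ∘ p) (suc e) d)
  ≡⟨ cong₂ _+_ before (cong₂ _+_ (ind-T pe) after) ⟩
    1
  ∎
  where
  open ≡-Reasoning
  d : ℕ
  d = n ∸ suc e
  e+[1+d]≡n : e + suc d ≡ n
  e+[1+d]≡n = trans (+-suc e d) (m+[n∸m]≡n e<n)
  before : sumFrom (ind ∘ p) 0 e ≡ 0
  before = sumFrom-≡0 0 e λ _ i<e → ind-¬T λ pi → <-irrefl (unique pi) i<e
  after : sumFrom (ind ∘ p) (suc e) d ≡ 0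
  after = sumFrom-≡0 (suc e) d λ e<i _ → ind-¬T λ pi → <-irrefl (sym (unique pi)) e<i

telescope : ∀ (r d : ℕ → ℕ) k c → (∀ {i} → i < k + c → r i + d i ≤ r (suc i)) →
            r k + sumFrom d k c ≤ r (k + c)
telescope r d k zero    _    = ≤-reflexive (trans (+-identityʳ (r k)) (cong r (sym (+-identityʳ k))))
telescope r d k (suc c) step = begin
  r k + (d k + sumFrom d (suc k) c)  ≡⟨ +-assoc (r k) (d k) _ ⟨
  r k + d k + sumFrom d (suc k) c    ≤⟨ +-monoˡ-≤ _ (step (m<m+n k z<s)) ⟩
  r (suc k) + sumFrom d (suc k) c    ≤⟨ telescope r d (suc k) c (λ {i} → step ∘ subst (i <_) (sym (+-suc k c))) ⟩
  r (suc k + c)                      ≡⟨ cong r (+-suc k c) ⟨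
  r (k + suc c)                      ∎
  where open ≤-Reasoning

module Runs (x : ℕ → ℕ) where

  ascent : ℕ → Bool
  ascent i = x i <ᵇ x (suc i)

  runStart : ℕ → Bool
  runStart zero    = true
  runStart (suc i) = not (ascent i)

  runStarts : ℕ → ℕ → ℕ
  runStarts k l = sumFrom (ind ∘ runStart) k (l ∸ k)

  runStarts≡1+descSeq : ∀ m → (∀ {i} → i < m → x i ≢ x (suc i)) →
                        runStarts 0 (suc m) ≡ 1 + descSeq (suc m) x
  runStarts≡1+descSeq m distinct = cong suc (begin
    sumFrom (ind ∘ runStart) 1 m                ≡⟨ sumFrom-suc _ 0 m ⟩
    sumFrom (ind ∘ not ∘ ascent) 0 m            ≡⟨ sumFrom-cong 0 m (λ _ i<m → cong ind (not-<ᵇ (distinct i<m))) ⟩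
    sumFrom (λ i → ind (x (suc i) <ᵇ x i)) 0 m  ≡⟨ sum-map-upTo _ m ⟨
    descSeq (suc m) x                           ∎)
    where open ≡-Reasoning

  incSeg⇒ascending : ∀ {a b} → T (incSeg x a b) → ∀ {i} → a ≤ i → i < b → T (ascent i)
  incSeg⇒ascending {a} {b} inc {i} a≤i i<b =
    subst (T ∘ ascent) (m+[n∸m]≡n a≤i)
      (applyUpTo⁻ id (b ∸ a) (map⁻ (all⁺ ascent _ inc)) (∸-monoˡ-< i<b a≤i))

  ascending⇒incSeg : ∀ {a b} → a ≤ b → (∀ {i} → a ≤ i → i < b → T (ascent i)) → T (incSeg x a b)
  ascending⇒incSeg {a} {b} a≤b asc =
    all⁻ ascent (map⁺ (applyUpTo⁺₁ id (b ∸ a) λ {j} j<b∸a →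
      asc (m≤m+n a j) (subst (a + j <_) (m+[n∸m]≡n a≤b) (+-monoʳ-< a j<b∸a))))

  module _ (n : ℕ) where

    runEnd : ℕ → Bool
    runEnd b = (suc b ≡ᵇ n) ∨ not (ascent b)

    record IsRunEnd (a b : ℕ) : Set where
      field
        a≤b       : a ≤ b
        b<n       : b < n
        ascending : ∀ {i} → a ≤ i → i < b → T (ascent i)
        stops     : T (runEnd b)

    open IsRunEnd

    runEnd∧ascent⇒last : ∀ {b} → T (runEnd b) → T (ascent b) → suc b ≡ n
    runEnd∧ascent⇒last {b} stop asc = ≡ᵇ⇒≡ (suc b) n (T-∨-not stop asc)

    runEnd⇒runStart : ∀ {b} → T (runEnd b) → suc b < n → T (runStart (suc b))
    runEnd⇒runStart {b} stop 1+b<n = T-∨⁻ʳ stop λ last → <-irrefl (≡ᵇ⇒≡ (suc b) n last) 1+b<n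

    runEnd-not-before : ∀ {a b e} → IsRunEnd a b → IsRunEnd a e → ¬ b < e
    runEnd-not-before r s b<e =
      <-irrefl (runEnd∧ascent⇒last (stops r) (ascending s (a≤b r) b<e)) (≤-<-trans b<e (b<n s))

    runEnd-unique : ∀ {a b e} → IsRunEnd a b → IsRunEnd a e → b ≡ e
    runEnd-unique r s = ≤-antisym (≮⇒≥ (runEnd-not-before s r)) (≮⇒≥ (runEnd-not-before r s))

    runEnd-refl : ∀ {a} → a < n → T (runEnd a) → IsRunEnd a a
    runEnd-refl a<n stop = record
      { a≤b = ≤-refl ; b<n = a<n ; ascending = λ a≤i i<a → ⊥-elim (<⇒≱ i<a a≤i) ; stops = stop }

    runEnd-extend : ∀ {a e} → T (ascent a) → IsRunEnd (suc a) e → IsRunEnd a e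
    runEnd-extend {a} asc r = record
      { a≤b = <⇒≤ (a≤b r) ; b<n = b<n r ; ascending = ascending′ ; stops = stops r }
      where
      ascending′ : ∀ {i} → a ≤ i → i < _ → T (ascent i)
      ascending′ a≤i i<e with m≤n⇒m<n∨m≡n a≤i
      ... | inj₁ a<i  = ascending r a<i i<e
      ... | inj₂ refl = asc

    runEnd-exists : ∀ {a} → a < n → Σ ℕ (IsRunEnd a)
    runEnd-exists a<n = go _ (m+[n∸m]≡n a<n)
      where
      go : ∀ d {a} → suc a + d ≡ n → Σ ℕ (IsRunEnd a)
      go zero {a} eq =
        a , runEnd-refl (≤-trans (m≤m+n (suc a) 0) (≤-reflexive eq))
                        (T-∨⁺ˡ (≡⇒≡ᵇ (suc a) n (trans (sym (+-identityʳ (suc a))) eq)))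
      go (suc d) {a} eq with T? (runEnd a)
      ... | yes stop = a , runEnd-refl (≤-trans (m≤m+n (suc a) (suc d)) (≤-reflexive eq)) stop
      ... | no ¬stop with go d {suc a} (trans (sym (+-suc (suc a) d)) eq)
      ...   | e , r = e , runEnd-extend (¬T-∨-not ¬stop) r

    -- The local leftMax of isRun only unfolds once a is a constructor.
    isRun-unfold : ∀ a b → isRun n x a b ≡ (a ≤ᵇ b) ∧ (b <ᵇ n) ∧ incSeg x a b ∧ runStart a ∧ runEnd b
    isRun-unfold zero    b = refl
    isRun-unfold (suc a) b = refl

    isRun⇒ : ∀ {a b} → T (isRun n x a b) → T (runStart a) × IsRunEnd a b
    isRun⇒ {a} {b} h =
      let a≤b   , h₁   = T-∧⁻ (subst T (isRun-unfold a b) h)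
          b<n   , h₂   = T-∧⁻ h₁
          inc   , h₃   = T-∧⁻ h₂
          start , stop = T-∧⁻ h₃
      in start , record { a≤b = ≤ᵇ⇒≤ a b a≤b ; b<n = <ᵇ⇒< b n b<n
                        ; ascending = incSeg⇒ascending inc ; stops = stop }

    runStart⇒isRun : ∀ {a b} → T (runStart a) → IsRunEnd a b → T (isRun n x a b)
    runStart⇒isRun {a} {b} start r = subst T (sym (isRun-unfold a b))
      (T-∧⁺ (≤⇒≤ᵇ (a≤b r)) (T-∧⁺ (<⇒<ᵇ (b<n r))
        (T-∧⁺ (ascending⇒incSeg (a≤b r) (ascending r)) (T-∧⁺ start (stops r)))))

    isRun-count : ∀ {a} → a < n → sumFrom (λ b → ind (isRun n x a b)) 0 n ≡ ind (runStart a)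
    isRun-count {a} a<n with T? (runStart a) | runEnd-exists a<n
    ... | no ¬start | _ =
      trans (sumFrom-≡0 0 n λ {b} _ _ → ind-¬T (¬start ∘ proj₁ ∘ isRun⇒ {a} {b})) (sym (ind-¬T ¬start))
    ... | yes start | e , r =
      trans (sumFrom-ind-unique (isRun n x a) (b<n r) (runStart⇒isRun start r)
                                (λ h → runEnd-unique (proj₂ (isRun⇒ h)) r))
            (sym (ind-T start))

    ascrunSeq≡runStarts : ascrunSeq n x ≡ runStarts 0 n
    ascrunSeq≡runStarts = begin
      ascrunSeq n x
        ≡⟨ sum-concatMap (λ a → map (λ b → ind (isRun n x a b)) (upTo n)) (upTo n) ⟩
      sum (map (λ a → sum (map (λ b → ind (isRun n x a b)) (upTo n))) (upTo n))
        ≡⟨ sum-map-upTo _ n ⟩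
      sumFrom (λ a → sum (map (λ b → ind (isRun n x a b)) (upTo n))) 0 n
        ≡⟨ sumFrom-cong 0 n (λ _ a<n → trans (sum-map-upTo _ n) (isRun-count a<n)) ⟩
      runStarts 0 n
        ∎
      where open ≡-Reasoning

    runStarts-run : ∀ {k e} → T (runStart k) → IsRunEnd k e → runStarts k (suc e) ≡ 1
    runStarts-run {k} {e} start r = begin
        sumFrom (ind ∘ runStart) k (suc e ∸ k)
      ≡⟨ cong (sumFrom _ k) (+-∸-assoc 1 (a≤b r)) ⟩
        ind (runStart k) + sumFrom (ind ∘ runStart) (suc k) (e ∸ k)
      ≡⟨ cong₂ _+_ (ind-T start) (sumFrom-≡0 (suc k) (e ∸ k) inside) ⟩
        1
      ∎
      where
      open ≡-Reasoning
      inside : ∀ {i} → suc k ≤ i → i < suc k + (e ∸ k) → ind (runStart i) ≡ 0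
      inside (s≤s k≤j) (s≤s j<k+[e∸k]) =
        ind-not (ascending r k≤j (subst (_ <_) (m+[n∸m]≡n (a≤b r)) j<k+[e∸k]))

record InverseOn (n : ℕ) (x w : ℕ → ℕ) : Set where
  field
    x<n : ∀ {i} → i < n → x i < n
    w<n : ∀ {p} → p < n → w p < n
    w∘x : ∀ {i} → i < n → w (x i) ≡ i
    x∘w : ∀ {p} → p < n → x (w p) ≡ p

  x-injective : ∀ {i j} → i < n → j < n → x i ≡ x j → i ≡ j
  x-injective i<n j<n xi≡xj = trans (sym (w∘x i<n)) (trans (cong w xi≡xj) (w∘x j<n))

module Reading {n : ℕ} {x w : ℕ → ℕ} (inv : InverseOn n x w) where
  open InverseOn inv
  open Runs x
  open IsRunEnd

  step : ℕ → ℕ → ℕ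
  step t p = if w p ≡ᵇ t then suc t else t

  step-found : ∀ {t p} → w p ≡ t → step t p ≡ suc t
  step-found {t} {p} wp≡t = cong (λ b → if b then suc t else t) (dec-true (w p ≟ t) wp≡t)

  step-missed : ∀ {t p} → w p ≢ t → step t p ≡ t
  step-missed {t} {p} wp≢t = cong (λ b → if b then suc t else t) (dec-false (w p ≟ t) wp≢t)

  scan : ℕ → ℕ → ℕ
  scan k p = foldl step k (upTo p)

  scan-suc : ∀ k p → scan k (suc p) ≡ step (scan k p) p
  scan-suc k p = trans (cong (foldl step k) (sym (upTo-∷ʳ p))) (foldl-∷ʳ step k p (upTo p))

  module _ {k e : ℕ} (run : IsRunEnd n k e) where

    -- After the positions 0 … p-1 the pass started at label k is looking for label t.
    record Scanned (p t : ℕ) : Set where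
      field
        k≤t      : k ≤ t
        t≤1+e    : t ≤ suc e
        end-seen : t ≡ suc e → x e < p
        pending  : t ≤ e → p ≤ x t

    open Scanned

    scanned-found : ∀ {p t} → p < n → w p ≡ t → Scanned p t → Scanned (suc p) (suc t)
    scanned-found {p} {t} p<n wp≡t s = record
      { k≤t = m≤n⇒m≤1+n (k≤t s) ; t≤1+e = s≤s t≤e
      ; end-seen = λ 1+t≡1+e → subst (λ j → x j < suc p) (suc-injective 1+t≡1+e) xt<1+p
      ; pending = λ 1+t≤e → subst (_< x (suc t)) xt≡p (<ᵇ⇒< _ _ (ascending run (k≤t s) 1+t≤e)) }
      where
      xt≡p : x t ≡ p
      xt≡p = trans (cong x (sym wp≡t)) (x∘w p<n)
      xt<1+p : x t < suc p
      xt<1+p = subst (_< suc p) (sym xt≡p) (n<1+n p)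
      t≤e : t ≤ e
      t≤e with m≤n⇒m<n∨m≡n (t≤1+e s)
      ... | inj₁ t<1+e = s≤s⁻¹ t<1+e
      ... | inj₂ t≡1+e = ⊥-elim (<-irrefl (trans wp≡t (trans t≡1+e last)) (w<n p<n))
        where
        ascent-e : T (ascent e)
        ascent-e = <⇒<ᵇ (subst (λ j → x e < x j) t≡1+e (subst (x e <_) (sym xt≡p) (end-seen s t≡1+e)))
        last : suc e ≡ n
        last = runEnd∧ascent⇒last n (stops run) ascent-e

    scanned-missed : ∀ {p t} → w p ≢ t → Scanned p t → Scanned (suc p) t
    scanned-missed {p} {t} wp≢t s = record
      { k≤t = k≤t s ; t≤1+e = t≤1+e s
      ; end-seen = m<n⇒m<1+n ∘ end-seen s
      ; pending = λ t≤e → ≤∧≢⇒< (pending s t≤e)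
                    (λ p≡xt → wp≢t (trans (cong w p≡xt) (w∘x (≤-<-trans t≤e (b<n run))))) }

    scanned : ∀ {p} → p ≤ n → Scanned p (scan k p)
    scanned {zero} _ = record
      { k≤t = ≤-refl ; t≤1+e = m≤n⇒m≤1+n (a≤b run)
      ; end-seen = λ k≡1+e → ⊥-elim (1+n≰n (subst (_≤ e) k≡1+e (a≤b run)))
      ; pending = λ _ → z≤n }
    scanned {suc p} p<n with w p ≟ scan k p
    ... | yes found = subst (Scanned (suc p)) (sym (trans (scan-suc k p) (step-found found)))
                        (scanned-found p<n found (scanned (<⇒≤ p<n)))
    ... | no missed = subst (Scanned (suc p)) (sym (trans (scan-suc k p) (step-missed missed)))
                        (scanned-missed missed (scanned (<⇒≤ p<n)))

    pass≡1+runEnd : pass n w k ≡ suc e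
    pass≡1+runEnd = ≤-antisym (t≤1+e s) (≮⇒≥ λ t<1+e →
      <⇒≱ (x<n (≤-<-trans (s≤s⁻¹ t<1+e) (b<n run))) (pending s (s≤s⁻¹ t<1+e)))
      where
      s : Scanned n (pass n w k)
      s = scanned ≤-refl

  passes-done : ∀ {fuel k} → n ≤ k → passes n w fuel k ≡ 0
  passes-done {zero}     _       = refl
  passes-done {suc fuel} {k} n≤k =
    cong (λ b → if b then 0 else suc (passes n w fuel (pass n w k))) (dec-true (n ≤? k) n≤k)

  passes-step : ∀ {fuel k} → k < n → passes n w (suc fuel) k ≡ suc (passes n w fuel (pass n w k))
  passes-step {fuel} {k} k<n =
    cong (λ b → if b then 0 else suc (passes n w fuel (pass n w k))) (dec-false (n ≤? k) (<⇒≱ k<n))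

  passes≡runStarts : ∀ fuel k → n ≤ k + fuel → (k < n → T (runStart k)) →
                     passes n w fuel k ≡ runStarts k n
  passes≡runStarts fuel k bound start with k <? n
  ... | no k≮n =
    trans (passes-done {fuel} (≮⇒≥ k≮n)) (cong (sumFrom _ k) (sym (m≤n⇒m∸n≡0 (≮⇒≥ k≮n))))
  passes≡runStarts zero k bound start | yes k<n =
    ⊥-elim (<⇒≱ k<n (subst (n ≤_) (+-identityʳ k) bound))
  passes≡runStarts (suc fuel) k bound start | yes k<n with runEnd-exists n k<n
  ... | e , run = begin
      passes n w (suc fuel) k
    ≡⟨ passes-step {fuel} k<n ⟩
      suc (passes n w fuel (pass n w k))
    ≡⟨ cong (suc ∘ passes n w fuel) (pass≡1+runEnd run) ⟩
      suc (passes n w fuel (suc e))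
    ≡⟨ cong suc (passes≡runStarts fuel (suc e) bound′ (runEnd⇒runStart n (stops run))) ⟩
      1 + runStarts (suc e) n
    ≡⟨ cong (_+ runStarts (suc e) n) (runStarts-run n (start k<n) run) ⟨
      runStarts k (suc e) + runStarts (suc e) n
    ≡⟨ sumFrom-split _ (m≤n⇒m≤1+n (a≤b run)) (b<n run) ⟨
      runStarts k n
    ∎
    where
    open ≡-Reasoning
    bound′ : n ≤ suc e + fuel
    bound′ = ≤-trans bound (≤-trans (≤-reflexive (+-suc k fuel)) (s≤s (+-monoˡ-≤ fuel (a≤b run))))

  readSeq≡runStarts : readSeq n w ≡ runStarts 0 n
  readSeq≡runStarts = passes≡runStarts n 0 ≤-refl (λ _ → tt)

toSeq-fromℕ< : ∀ {n} (f : Fin n → ℕ) {i} (i<n : i < n) → toSeq f i ≡ f (fromℕ< i<n)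
toSeq-fromℕ< {n} f {i} i<n with i <? n
... | yes _   = refl
... | no i≮n = ⊥-elim (i≮n i<n)

toSeq-toℕ : ∀ {n} (f : Fin n → ℕ) (s : Fin n) → toSeq f (toℕ s) ≡ f s
toSeq-toℕ f s = trans (toSeq-fromℕ< f (toℕ<n s)) (cong f (fromℕ<-toℕ s _))

toSeq-toℕ-< : ∀ {n} (f : Fin n → Fin n) {i} → i < n → toSeq (toℕ ∘ f) i < n
toSeq-toℕ-< f i<n = subst (_< _) (sym (toSeq-fromℕ< _ i<n)) (toℕ<n _)

toSeq-toℕ-cancel : ∀ {n} (f g : Fin n → Fin n) → (∀ {s} → g (f s) ≡ s) →
                   ∀ {i} → i < n → toSeq (toℕ ∘ g) (toSeq (toℕ ∘ f) i) ≡ i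
toSeq-toℕ-cancel f g g∘f {i} i<n = begin
  toSeq (toℕ ∘ g) (toSeq (toℕ ∘ f) i)       ≡⟨ cong (toSeq (toℕ ∘ g)) (toSeq-fromℕ< _ i<n) ⟩
  toSeq (toℕ ∘ g) (toℕ (f (fromℕ< i<n)))   ≡⟨ toSeq-toℕ (toℕ ∘ g) _ ⟩
  toℕ (g (f (fromℕ< i<n)))                 ≡⟨ cong toℕ g∘f ⟩
  toℕ (fromℕ< i<n)                         ≡⟨ toℕ-fromℕ< i<n ⟩
  i                                        ∎
  where open ≡-Reasoning

positions labels : ∀ {n} → Permutation′ n → ℕ → ℕ
positions π = toSeq (λ s → toℕ (π ⟨$⟩ʳ s))
labels    π = toSeq (λ p → toℕ (π ⟨$⟩ˡ p))

positions-labels-inverseOn : ∀ {n} (π : Permutation′ n) → InverseOn n (positions π) (labels π)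
positions-labels-inverseOn π = record
  { x<n = toSeq-toℕ-< (π ⟨$⟩ʳ_)
  ; w<n = toSeq-toℕ-< (π ⟨$⟩ˡ_)
  ; w∘x = toSeq-toℕ-cancel (π ⟨$⟩ʳ_) (π ⟨$⟩ˡ_) (inverseˡ π)
  ; x∘w = toSeq-toℕ-cancel (π ⟨$⟩ˡ_) (π ⟨$⟩ʳ_) (inverseʳ π)
  }

lexLt⇒pile-step : ∀ {a b c d} → LexLt (a , c) (b , d) → a + ind (d <ᵇ c) ≤ b
lexLt⇒pile-step {a} {b} {c} {d} (inj₁ a<b) =
  ≤-trans (+-monoʳ-≤ a (ind≤1 (d <ᵇ c))) (subst (_≤ b) (+-comm 1 a) a<b)
lexLt⇒pile-step {a} {b} {c} {d} (inj₂ (refl , c<d)) =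
  ≤-reflexive (trans (cong (λ m → a + ind m) (dec-false (d <? c) (<⇒≯ c<d))) (+-identityʳ a))

sorted⇒pile-step : ∀ {n} {π : Permutation′ n} {ρ : Fin n → ℕ} → SortsOnQueues π ρ →
                   ∀ {i} → suc i < n →
                   toSeq ρ i + ind (positions π (suc i) <ᵇ positions π i) ≤ toSeq ρ (suc i)
sorted⇒pile-step {π = π} {ρ} sorted {i} 1+i<n = pile-step (<-trans (n<1+n i) 1+i<n)
  where
  pile-step : (i<n : i < _) →
              toSeq ρ i + ind (positions π (suc i) <ᵇ positions π i) ≤ toSeq ρ (suc i)
  pile-step i<n
    rewrite toSeq-fromℕ< ρ i<n | toSeq-fromℕ< ρ 1+i<n
          | toSeq-fromℕ< (λ s → toℕ (π ⟨$⟩ʳ s)) i<n | toSeq-fromℕ< (λ s → toℕ (π ⟨$⟩ʳ s)) 1+i<n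
    = lexLt⇒pile-step (Equivalence.to (sorted (fromℕ< i<n) (fromℕ< 1+i<n))
        (subst₂ _<_ (sym (toℕ-fromℕ< i<n)) (sym (toℕ-fromℕ< 1+i<n)) (n<1+n i)))

sorted⇒1+desc≤lastPile : ∀ m (π : Permutation′ (suc m)) (ρ : Fin (suc m) → ℕ) →
                         SortsOnQueues π ρ → ρ zero ≡ 1 → 1 + desc π ≤ ρ (fromℕ m)
sorted⇒1+desc≤lastPile m π ρ sorted ρ₀≡1 = begin
    1 + desc π
  ≡⟨ cong₂ _+_ (trans (sym ρ₀≡1) (sym (toSeq-toℕ ρ zero))) (sum-map-upTo _ m) ⟩
    toSeq ρ 0 + sumFrom descentAt 0 m
  ≤⟨ telescope (toSeq ρ) descentAt 0 m (λ {i} → sorted⇒pile-step {π = π} {ρ} sorted {i} ∘ s≤s) ⟩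
    toSeq ρ m
  ≡⟨ cong (toSeq ρ) (toℕ-fromℕ m) ⟨
    toSeq ρ (toℕ (fromℕ m))
  ≡⟨ toSeq-toℕ ρ (fromℕ m) ⟩
    ρ (fromℕ m)
  ∎
  where
  open ≤-Reasoning
  descentAt : ℕ → ℕ
  descentAt i = ind (positions π (suc i) <ᵇ positions π i)

lemma2 : (m : ℕ) (π : Permutation′ (suc m)) (ρ : Fin (suc m) → ℕ) →
         SortsOnQueues π ρ → ρ zero ≡ 1 →
         (1 + desc π ≤ ρ (fromℕ m)) × (1 + desc π ≡ ascrun π) × (ascrun π ≡ readInv π)
lemma2 m π ρ sorted ρ₀≡1 =
  sorted⇒1+desc≤lastPile m π ρ sorted ρ₀≡1 ,
  trans (sym starts≡1+desc) (sym ascrun≡starts) ,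
  trans ascrun≡starts (sym (Reading.readSeq≡runStarts inv))
  where
  open Runs (positions π)
  inv : InverseOn (suc m) (positions π) (labels π)
  inv = positions-labels-inverseOn π
  ascrun≡starts : ascrun π ≡ runStarts 0 (suc m)
  ascrun≡starts = ascrunSeq≡runStarts (suc m)
  starts≡1+desc : runStarts 0 (suc m) ≡ 1 + desc π
  starts≡1+desc = runStarts≡1+descSeq m λ {i} i<m eq →
    1+n≢n (sym (InverseOn.x-injective inv (m<n⇒m<1+n i<m) (s≤s i<m) eq))
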